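{- Let $T$ be a finite rooted ordered tree with root $r$ and let $u,v\in T\setminus\{r\}$. Then $u<^*v$ if and only if $v<u$.
   Context: $<$ denotes depth-first traversal order (preorder) of $T$, and $<^*$ denotes depth-first traversal order of the dual tree $T^*$. The dual $T^*$ has the same vertex set and root $r$; with $rmc_T(u)$ the rightmost child and $ils_T(u)$ the immediate left sibling of $u$ in $T$, parents and sibling order in $T^*$ are given by: (1a) $r$ has no parent in $T^*$; (1b) if $v=rmc_T(r)$ then $v$ is the rightmost child of $r$ in $T^*$; (2) if $v=rmc_T(u)$ with $u\ne r$, then $v$ is the immediate left sibling of $u$ in $T^*$; (3) if $v=ils_T(u)$, then $v$ is the rightmost child of $u$ in $T^*$. $T^*$ is a rooted ordered tree. -}

module Defs where

open import Data.Nat using (ℕ; suc)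
open import Data.Fin using (Fin; toℕ)
open import Data.List using (List; length; lookup)
open import Data.Product using (Σ; _×_; ∃-syntax)
open import Data.Sum using (_⊎_)
open import Relation.Nullary using (¬_)
open import Relation.Binary.PropositionalEquality using (_≡_)
open import Relation.Binary.Construct.Closure.Transitive using (TransClosure)
open import Relation.Binary.Construct.Closure.ReflexiveTransitive using (Star)

data Tree : Set where
  node : List Tree → Tree

-- Vertices of a tree, as addresses from the root.
data Pos : Tree → Set where
  root  : ∀ {t} → Pos t
  child : ∀ {ts} (i : Fin (length ts)) → Pos (lookup ts i) → Pos (node ts)

-- RMC w v : v is the rightmost child of w in T  (v = rmc_T(w)).
data RMC : {t : Tree} → Pos t → Pos t → Set where
  rmc-here  : ∀ {ts} (i : Fin (length ts)) → suc (toℕ i) ≡ length ts →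
              RMC {node ts} root (child i root)
  rmc-there : ∀ {ts} (i : Fin (length ts)) {p q : Pos (lookup ts i)} →
              RMC p q → RMC {node ts} (child i p) (child i q)

-- ILS u v : v is the immediate left sibling of u in T  (v = ils_T(u)).
data ILS : {t : Tree} → Pos t → Pos t → Set where
  ils-here  : ∀ {ts} (i j : Fin (length ts)) → suc (toℕ j) ≡ toℕ i →
              ILS {node ts} (child i root) (child j root)
  ils-there : ∀ {ts} (i : Fin (length ts)) {p q : Pos (lookup ts i)} →
              ILS p q → ILS {node ts} (child i p) (child i q)

-- Generic ordered-tree notions for a tree presented on a vertex type V by
--   Rm w x : x is the rightmost child of w,
--   Ls u a : a is the immediate left sibling of u.
module OrderedTree {V : Set} (Rm Ls : V → V → Set) where

  StepRight : V → V → Set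
  StepRight a b = Ls b a

  LeftOf : V → V → Set
  LeftOf = TransClosure StepRight

  ChildOf : V → V → Set
  ChildOf x w = ∃[ y ] (Rm w y × Star StepRight x y)

  ParentOf : V → V → Set
  ParentOf w x = ChildOf x w

  ProperAnc : V → V → Set
  ProperAnc = TransClosure ParentOf

  AncEq : V → V → Set
  AncEq = Star ParentOf

  -- depth-first traversal (preorder): u precedes v iff u is a proper ancestor of v,
  -- or u and v descend (weakly) from siblings a, b with a to the left of b.
  DFS< : V → V → Set
  DFS< u v = ProperAnc u v ⊎ (∃[ a ] ∃[ b ] (LeftOf a b × AncEq a u × AncEq b v))

_<T_ : ∀ {t} → Pos t → Pos t → Set
_<T_ {t} u v = OrderedTree.DFS< (RMC {t}) (ILS {t}) u v

-- The dual tree T*: same vertices and root.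
-- RMC* w v : v is the rightmost child of w in T*
--   (1b) w = r and v = rmc_T(r);   (3) v = ils_T(w).
RMC* : ∀ {t} → Pos t → Pos t → Set
RMC* {t} w v = (w ≡ root × RMC {t} root v) ⊎ ILS w v

-- ILS* u v : v is the immediate left sibling of u in T*
--   (2) v = rmc_T(u) with u ≠ r.
ILS* : ∀ {t} → Pos t → Pos t → Set
ILS* {t} u v = ¬ (u ≡ root) × RMC {t} u v

_<*_ : ∀ {t} → Pos t → Pos t → Set
_<*_ {t} u v = OrderedTree.DFS< (RMC* {t}) (ILS* {t}) u v

module Submission where

-- Both orders are compared with the preorder ≺ of T read off addresses: v ≺ u iff v is a
-- proper ancestor of u (⊏) or lies in a branch to the left of u (◁); for T this is a direct
-- unfolding of the definition. In T*, rule (3) makes ils(u) the rightmost T*-child of u and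
-- rule (2) lets one move T*-left by descending to rightmost T-children, so the proper
-- T*-descendants of a non-root a are exactly the nodes under a left sibling of a in T, the
-- root is a T*-ancestor of everything, and a is a T*-left sibling of b iff a is reached from
-- b ≠ r by a chain of rightmost children. Unfolding u <* v with these descriptions gives v ≺ u,
-- and conversely the point where the T-path to u leaves the rightmost spine below v (or
-- below the sibling of v's branch) provides the witnesses for u <* v.

open import Defs
open import Data.Fin using (Fin; zero; suc; toℕ; fromℕ)
open import Data.Fin.Properties using (toℕ-fromℕ)
open import Data.List using (List; _∷_; length)
open import Data.Nat using (zero; suc; _<_; s≤s; z≤n)
open import Data.Nat.Properties using (<-trans; ≤-reflexive)
open import Data.Product using (_×_; _,_; ∃-syntax)
open import Data.Sum as Sum using (_⊎_; inj₁; inj₂)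
open import Data.Empty using (⊥-elim)
open import Function.Bundles using (_⇔_; mk⇔)
open import Relation.Nullary using (¬_)
open import Relation.Binary.PropositionalEquality using (_≡_; _≢_; refl; cong)
open import Relation.Binary.Construct.Closure.Transitive
  using (TransClosure; [_]; _∷_; _∷ʳ_)
open import Relation.Binary.Construct.Closure.ReflexiveTransitive
  using (Star; ε; _◅_; _◅◅_; gmap)

module Primal {t : Tree} = OrderedTree (RMC {t}) (ILS {t})
module Dual   {t : Tree} = OrderedTree (RMC* {t}) (ILS* {t})

module _ {A : Set} {R : A → A → Set} where

  ⁺⇒⋆ : ∀ {x y} → TransClosure R x y → Star R x y
  ⁺⇒⋆ [ r ]    = r ◅ ε
  ⁺⇒⋆ (r ∷ rs) = r ◅ ⁺⇒⋆ rs

  _⁺◅◅_ : ∀ {x y z} → TransClosure R x y → Star R y z → TransClosure R x z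
  rs ⁺◅◅ ε          = rs
  rs ⁺◅◅ (r ◅ rs′) = (rs ∷ʳ r) ⁺◅◅ rs′

  map-last : ∀ {a b} → (∀ {w} → R w a → R w b) →
             ∀ {x} → TransClosure R x a → TransClosure R x b
  map-last f [ r ]    = [ f r ]
  map-last f (r ∷ rs) = r ∷ map-last f rs

⁺-gmap : ∀ {A B : Set} {R : A → A → Set} {S : B → B → Set} (f : A → B) →
         (∀ {x y} → R x y → S (f x) (f y)) →
         ∀ {x y} → TransClosure R x y → TransClosure S (f x) (f y)
⁺-gmap f g [ r ]    = [ g r ]
⁺-gmap f g (r ∷ rs) = g r ∷ ⁺-gmap f g rs

⁺-reverse : ∀ {A : Set} {R S : A → A → Set} → (∀ {x y} → R x y → S y x) →
            ∀ {x y} → TransClosure R x y → TransClosure S y x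
⁺-reverse f [ r ]    = [ f r ]
⁺-reverse f (r ∷ rs) = ⁺-reverse f rs ∷ʳ f r

consecutive⁺ : ∀ {n} {R : Fin n → Fin n → Set} →
               (∀ {a b} → suc (toℕ a) ≡ toℕ b → R a b) →
               ∀ {i j} → toℕ i < toℕ j → TransClosure R i j
consecutive⁺ step {zero} {suc zero} _ = [ step refl ]
consecutive⁺ step {zero} {suc (suc j)} _ =
  step refl ∷ ⁺-gmap suc (λ r → r) (consecutive⁺ (λ e → step (cong suc e)) {zero} {suc j} (s≤s z≤n))
consecutive⁺ step {suc i} {suc j} (s≤s i<j) =
  ⁺-gmap suc (λ r → r) (consecutive⁺ (λ e → step (cong suc e)) i<j)

≡fromℕ⊎<fromℕ : ∀ {n} (k : Fin (suc n)) → k ≡ fromℕ n ⊎ toℕ k < toℕ (fromℕ n)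
≡fromℕ⊎<fromℕ {zero}  zero    = inj₁ refl
≡fromℕ⊎<fromℕ {suc n} zero    = inj₂ (s≤s z≤n)
≡fromℕ⊎<fromℕ {suc n} (suc k) = Sum.map (cong suc) s≤s (≡fromℕ⊎<fromℕ k)

infix 4 _⊏_ _≼_ _◁_ _≺_

data _⊏_ : ∀ {t} → Pos t → Pos t → Set where
  here  : ∀ {ts} {i : Fin (length ts)} {p} → root ⊏ child {ts} i p
  there : ∀ {ts} (k : Fin (length ts)) {p q} → p ⊏ q → child {ts} k p ⊏ child k q

_≼_ : ∀ {t} → Pos t → Pos t → Set
a ≼ b = a ≡ b ⊎ a ⊏ b

data _◁_ : ∀ {t} → Pos t → Pos t → Set where
  here  : ∀ {ts} {i j : Fin (length ts)} {p q} → toℕ i < toℕ j → child {ts} i p ◁ child j q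
  there : ∀ {ts} (k : Fin (length ts)) {p q} → p ◁ q → child {ts} k p ◁ child k q

_≺_ : ∀ {t} → Pos t → Pos t → Set
v ≺ u = v ⊏ u ⊎ v ◁ u

data UnderLeftSibling : ∀ {t} → Pos t → Pos t → Set where
  here  : ∀ {ts} {i j : Fin (length ts)} {p} → toℕ i < toℕ j →
          UnderLeftSibling {node ts} (child i p) (child j root)
  there : ∀ {ts} (k : Fin (length ts)) {p q} → UnderLeftSibling p q →
          UnderLeftSibling {node ts} (child k p) (child k q)

⊏-trans : ∀ {t} {a b c : Pos t} → a ⊏ b → b ⊏ c → a ⊏ c
⊏-trans here        (there _ _)  = here
⊏-trans (there k p) (there .k q) = there k (⊏-trans p q)

⊏-≼-trans : ∀ {t} {a b c : Pos t} → a ⊏ b → b ≼ c → a ⊏ c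
⊏-≼-trans p (inj₁ refl) = p
⊏-≼-trans p (inj₂ q)    = ⊏-trans p q

⊏-nonroot : ∀ {t} {a b : Pos t} → a ⊏ b → b ≢ root
⊏-nonroot here        ()
⊏-nonroot (there _ _) ()

root-≼ : ∀ {t} (p : Pos t) → root ≼ p
root-≼ root        = inj₁ refl
root-≼ (child _ _) = inj₂ here

◁-trans : ∀ {t} {a b c : Pos t} → a ◁ b → b ◁ c → a ◁ c
◁-trans (here x)    (here y)     = here (<-trans x y)
◁-trans (here x)    (there _ _)  = here x
◁-trans (there _ _) (here y)     = here y
◁-trans (there k l) (there .k m) = there k (◁-trans l m)

◁-≼ʳ : ∀ {t} {a b u : Pos t} → a ◁ b → b ≼ u → a ◁ u
◁-≼ʳ l           (inj₁ refl)            = l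
◁-≼ʳ (here x)    (inj₂ (there _ _))     = here x
◁-≼ʳ (there k l) (inj₂ (there .k b⊏u)) = there k (◁-≼ʳ l (inj₂ b⊏u))

◁-≼ˡ : ∀ {t} {a b v : Pos t} → a ◁ b → a ≼ v → v ◁ b
◁-≼ˡ l           (inj₁ refl)            = l
◁-≼ˡ (here x)    (inj₂ (there _ _))     = here x
◁-≼ˡ (there k l) (inj₂ (there .k a⊏v)) = there k (◁-≼ˡ l (inj₂ a⊏v))

UnderLeftSibling⇒◁ : ∀ {t} {v a : Pos t} → UnderLeftSibling v a → v ◁ a
UnderLeftSibling⇒◁ (here x)    = here x
UnderLeftSibling⇒◁ (there k l) = there k (UnderLeftSibling⇒◁ l)

UnderLeftSibling-nonroot : ∀ {t} {v a : Pos t} → UnderLeftSibling v a → a ≢ root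
UnderLeftSibling-nonroot (here _)    ()
UnderLeftSibling-nonroot (there _ _) ()

UnderLeftSibling-trans : ∀ {t} {a b c : Pos t} →
  UnderLeftSibling a b → UnderLeftSibling b c → UnderLeftSibling a c
UnderLeftSibling-trans (here x)    (here y)     = here (<-trans x y)
UnderLeftSibling-trans (there _ _) (here y)     = here y
UnderLeftSibling-trans (there k l) (there .k m) = there k (UnderLeftSibling-trans l m)

UnderLeftSibling-⊏ : ∀ {t} {b a u : Pos t} → UnderLeftSibling u a → b ⊏ a → b ⊏ u
UnderLeftSibling-⊏ (here _)    here           = here
UnderLeftSibling-⊏ (there _ _) here           = here
UnderLeftSibling-⊏ (there k l) (there .k b⊏a) = there k (UnderLeftSibling-⊏ l b⊏a)

◁-split : ∀ {t} {v u : Pos t} → v ◁ u →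
          UnderLeftSibling v u ⊎ ∃[ b ] (UnderLeftSibling v b × b ⊏ u)
◁-split (here {j = j} {q = q} x) with root-≼ q
... | inj₁ refl   = inj₁ (here x)
... | inj₂ root⊏q = inj₂ (child j root , here x , there j root⊏q)
◁-split (there k l) with ◁-split l
... | inj₁ v⇠u             = inj₁ (there k v⇠u)
... | inj₂ (b , v⇠b , b⊏u) = inj₂ (child k b , there k v⇠b , there k b⊏u)

-- The depth-first order of T

rmc⇒⊏ : ∀ {t} {w y : Pos t} → RMC w y → w ⊏ y
rmc⇒⊏ (rmc-here _ _)  = here
rmc⇒⊏ (rmc-there i r) = there i (rmc⇒⊏ r)

ils-⊏ : ∀ {t} {w b a : Pos t} → ILS b a → w ⊏ b → w ⊏ a
ils-⊏ (ils-here _ _ _) here           = here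
ils-⊏ (ils-there _ _)  here           = here
ils-⊏ (ils-there i s)  (there .i w⊏b) = there i (ils-⊏ s w⊏b)

ils⇒◁ : ∀ {t} {b a : Pos t} → ILS b a → a ◁ b
ils⇒◁ (ils-here _ _ e) = here (≤-reflexive e)
ils⇒◁ (ils-there i s)  = there i (ils⇒◁ s)

child⇒⊏ : ∀ {t} {x w : Pos t} → Primal.ChildOf x w → w ⊏ x
child⇒⊏ (_ , r , steps) = go steps (rmc⇒⊏ r)
  where
  go : ∀ {x y w} → Star Primal.StepRight x y → w ⊏ y → w ⊏ x
  go ε           w⊏y = w⊏y
  go (s ◅ steps) w⊏y = ils-⊏ s (go steps w⊏y)

ancestor⇒⊏ : ∀ {t} {v u : Pos t} → Primal.ProperAnc v u → v ⊏ u
ancestor⇒⊏ [ c ]    = child⇒⊏ c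
ancestor⇒⊏ (c ∷ cs) = ⊏-trans (child⇒⊏ c) (ancestor⇒⊏ cs)

ancestorEq⇒≼ : ∀ {t} {a v : Pos t} → Primal.AncEq a v → a ≼ v
ancestorEq⇒≼ ε        = inj₁ refl
ancestorEq⇒≼ (c ◅ cs) = inj₂ (⊏-≼-trans (child⇒⊏ c) (ancestorEq⇒≼ cs))

leftOf⇒◁ : ∀ {t} {a b : Pos t} → Primal.LeftOf a b → a ◁ b
leftOf⇒◁ [ s ]    = ils⇒◁ s
leftOf⇒◁ (s ∷ ss) = ◁-trans (ils⇒◁ s) (leftOf⇒◁ ss)

<T⇒≺ : ∀ {t} {v u : Pos t} → v <T u → v ≺ u
<T⇒≺ (inj₁ v↑u)                     = inj₁ (ancestor⇒⊏ v↑u)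
<T⇒≺ (inj₂ (_ , _ , a←b , a≼v , b≼u)) =
  inj₂ (◁-≼ˡ (◁-≼ʳ (leftOf⇒◁ a←b) (ancestorEq⇒≼ b≼u)) (ancestorEq⇒≼ a≼v))

rmc-last : ∀ {t ts} → RMC {node (t ∷ ts)} root (child (fromℕ (length ts)) root)
rmc-last = rmc-here _ (cong suc (toℕ-fromℕ _))

siblings⇒leftOf : ∀ {ts} {i j : Fin (length ts)} → toℕ i < toℕ j →
                  Primal.LeftOf {node ts} (child i root) (child j root)
siblings⇒leftOf {ts} i<j =
  ⁺-gmap (λ a → child a root) (λ s → s)
    (consecutive⁺ {R = λ a b → ILS {node ts} (child b root) (child a root)} (ils-here _ _) i<j)

root-parent : ∀ {ts} (k : Fin (length ts)) → Primal.ParentOf {node ts} root (child k root)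
root-parent {t ∷ ts} k with ≡fromℕ⊎<fromℕ k
... | inj₁ refl  = child k root , rmc-last , ε
... | inj₂ k<rmc = child _ root , rmc-last , ⁺⇒⋆ (siblings⇒leftOf k<rmc)

lift-child : ∀ {ts} (k : Fin (length ts)) {x w} →
             Primal.ChildOf x w → Primal.ChildOf {node ts} (child k x) (child k w)
lift-child k (y , r , steps) = child k y , rmc-there k r , gmap (child k) (ils-there k) steps

root-ancestorEq : ∀ {t} (p : Pos t) → Primal.AncEq root p
root-ancestorEq root        = ε
root-ancestorEq (child k p) = root-parent k ◅ gmap (child k) (lift-child k) (root-ancestorEq p)

⊏⇒ancestor : ∀ {t} {v u : Pos t} → v ⊏ u → Primal.ProperAnc v u
⊏⇒ancestor (here {i = i} {p = p}) = [ root-parent i ] ⁺◅◅ gmap (child i) (lift-child i) (root-ancestorEq p)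
⊏⇒ancestor (there k v⊏u)          = ⁺-gmap (child k) (lift-child k) (⊏⇒ancestor v⊏u)

◁⇒leftOf-ancestors : ∀ {t} {v u : Pos t} → v ◁ u →
  ∃[ a ] ∃[ b ] (Primal.LeftOf a b × Primal.AncEq a v × Primal.AncEq b u)
◁⇒leftOf-ancestors (here {i = i} {j} {p} {q} i<j) =
  child i root , child j root , siblings⇒leftOf i<j ,
  gmap (child i) (lift-child i) (root-ancestorEq p) , gmap (child j) (lift-child j) (root-ancestorEq q)
◁⇒leftOf-ancestors (there k v◁u) with ◁⇒leftOf-ancestors v◁u
... | a , b , a←b , a≼v , b≼u =
  child k a , child k b , ⁺-gmap (child k) (ils-there k) a←b ,
  gmap (child k) (lift-child k) a≼v , gmap (child k) (lift-child k) b≼u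

≺⇒<T : ∀ {t} {v u : Pos t} → v ≺ u → v <T u
≺⇒<T (inj₁ v⊏u) = inj₁ (⊏⇒ancestor v⊏u)
≺⇒<T (inj₂ v◁u) = inj₂ (◁⇒leftOf-ancestors v◁u)

-- Ancestors and left siblings in the dual tree T*

rmc-nonroot : ∀ {t} {w y : Pos t} → RMC w y → y ≢ root
rmc-nonroot (rmc-here _ _)  ()
rmc-nonroot (rmc-there _ _) ()

ils-nonroot : ∀ {t} {w y : Pos t} → ILS w y → y ≢ root
ils-nonroot (ils-here _ _ _) ()
ils-nonroot (ils-there _ _)  ()

ils-source-nonroot : ∀ {t} {w y : Pos t} → ILS w y → w ≢ root
ils-source-nonroot (ils-here _ _ _) ()
ils-source-nonroot (ils-there _ _)  ()

child*-nonroot : ∀ {t} {x w : Pos t} → Dual.ChildOf x w → x ≢ root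
child*-nonroot (_ , inj₁ (_ , r) , ε) = rmc-nonroot r
child*-nonroot (_ , inj₂ s , ε)       = ils-nonroot s
child*-nonroot (_ , _ , (_ , r) ◅ _)  = rmc-nonroot r

rmc-UnderLeftSibling : ∀ {t} {a b w : Pos t} → RMC b a → UnderLeftSibling b w → UnderLeftSibling a w
rmc-UnderLeftSibling (rmc-there _ _) (here x)     = here x
rmc-UnderLeftSibling (rmc-there i r) (there .i l) = there i (rmc-UnderLeftSibling r l)

ils⇒UnderLeftSibling : ∀ {t} {w y : Pos t} → ILS w y → UnderLeftSibling y w
ils⇒UnderLeftSibling (ils-here _ _ e) = here (≤-reflexive e)
ils⇒UnderLeftSibling (ils-there i s)  = there i (ils⇒UnderLeftSibling s)

child*⇒UnderLeftSibling : ∀ {t} {x w : Pos t} → Dual.ChildOf x w → w ≢ root → UnderLeftSibling x w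
child*⇒UnderLeftSibling (_ , inj₁ (w≡root , _) , _) w≢root = ⊥-elim (w≢root w≡root)
child*⇒UnderLeftSibling (_ , inj₂ s , steps)        _      = go steps (ils⇒UnderLeftSibling s)
  where
  go : ∀ {x y w} → Star Dual.StepRight x y → UnderLeftSibling y w → UnderLeftSibling x w
  go ε                  l = l
  go ((_ , r) ◅ steps) l = rmc-UnderLeftSibling r (go steps l)

ancestor*⇒UnderLeftSibling : ∀ {t} {u v : Pos t} → Dual.ProperAnc u v → u ≢ root →
                              UnderLeftSibling v u
ancestor*⇒UnderLeftSibling [ c ]    u≢root = child*⇒UnderLeftSibling c u≢root
ancestor*⇒UnderLeftSibling (c ∷ cs) u≢root =
  UnderLeftSibling-trans (ancestor*⇒UnderLeftSibling cs (child*-nonroot c))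
                         (child*⇒UnderLeftSibling c u≢root)

ancestorEq*⇒UnderLeftSibling : ∀ {t} {a u : Pos t} → Dual.AncEq a u → a ≢ root →
                                a ≡ u ⊎ UnderLeftSibling u a
ancestorEq*⇒UnderLeftSibling ε        _      = inj₁ refl
ancestorEq*⇒UnderLeftSibling (c ◅ cs) a≢root = inj₂ (ancestor*⇒UnderLeftSibling ([ c ] ⁺◅◅ cs) a≢root)

leftOf*⇒rmc⁺ : ∀ {t} {a b : Pos t} → Dual.LeftOf a b → TransClosure RMC b a × b ≢ root
leftOf*⇒rmc⁺ [ b≢root , r ] = [ r ] , b≢root
leftOf*⇒rmc⁺ ((_ , r) ∷ ss) with leftOf*⇒rmc⁺ ss
... | rs , b≢root = rs ∷ʳ r , b≢root

rmc⁺⇒leftOf* : ∀ {t} {b a : Pos t} → TransClosure RMC b a → b ≢ root → Dual.LeftOf a b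
rmc⁺⇒leftOf* [ r ]    b≢root = [ b≢root , r ]
rmc⁺⇒leftOf* (r ∷ rs) b≢root = rmc⁺⇒leftOf* rs (rmc-nonroot r) ∷ʳ (b≢root , r)

rmc⁺⇒⊏ : ∀ {t} {b a : Pos t} → TransClosure RMC b a → b ⊏ a
rmc⁺⇒⊏ [ r ]    = rmc⇒⊏ r
rmc⁺⇒⊏ (r ∷ rs) = ⊏-trans (rmc⇒⊏ r) (rmc⁺⇒⊏ rs)

<*⇒≺ : ∀ {t} {u v : Pos t} → u <* v → u ≢ root → v ≺ u
<*⇒≺ (inj₁ u↑v) u≢root = inj₂ (UnderLeftSibling⇒◁ (ancestor*⇒UnderLeftSibling u↑v u≢root))
<*⇒≺ (inj₂ (a , b , a←b , a≼u , b≼v)) _ with leftOf*⇒rmc⁺ a←b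
... | rs , b≢root
  with rmc⁺⇒⊏ rs
... | b⊏a
  with ancestorEq*⇒UnderLeftSibling a≼u (⊏-nonroot b⊏a)
     | ancestorEq*⇒UnderLeftSibling b≼v b≢root
... | inj₁ refl | inj₁ refl = inj₁ b⊏a
... | inj₁ refl | inj₂ v⇠b  = inj₂ (◁-≼ʳ (UnderLeftSibling⇒◁ v⇠b) (inj₂ b⊏a))
... | inj₂ u⇠a  | inj₁ refl = inj₁ (UnderLeftSibling-⊏ u⇠a b⊏a)
... | inj₂ u⇠a  | inj₂ v⇠b  = inj₂ (◁-≼ʳ (UnderLeftSibling⇒◁ v⇠b) (inj₂ (UnderLeftSibling-⊏ u⇠a b⊏a)))

ils⇒parent* : ∀ {t} {b a : Pos t} → ILS b a → Dual.ParentOf b a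
ils⇒parent* {a = a} s = a , inj₂ s , ε

leftOf⇒ancestor* : ∀ {t} {a b : Pos t} → Primal.LeftOf a b → Dual.ProperAnc b a
leftOf⇒ancestor* = ⁺-reverse ils⇒parent*

root-parent*-last : ∀ {t ts} → Dual.ParentOf {node (t ∷ ts)} root (child (fromℕ (length ts)) root)
root-parent*-last = _ , inj₁ (refl , rmc-last) , ε

root-ancestor*-child : ∀ {ts} (k : Fin (length ts)) → Dual.ProperAnc {node ts} root (child k root)
root-ancestor*-child {_ ∷ _} k with ≡fromℕ⊎<fromℕ k
... | inj₁ refl  = [ root-parent*-last ]
... | inj₂ k<rmc = root-parent*-last ∷ leftOf⇒ancestor* (siblings⇒leftOf k<rmc)

module _ {ts : List Tree} (i : Fin (length ts)) where

  rmc⇒stepRight* : ∀ {x y} → RMC y x → Dual.StepRight {node ts} (child i x) (child i y)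
  rmc⇒stepRight* r = (λ ()) , rmc-there i r

  lift-child* : ∀ {x w} → Dual.ChildOf x w → w ≢ root → Dual.ChildOf {node ts} (child i x) (child i w)
  lift-child* (_ , inj₁ (w≡root , _) , _)  w≢root = ⊥-elim (w≢root w≡root)
  lift-child* (y , inj₂ s , steps)         _      =
    child i y , inj₂ (ils-there i s) , gmap (child i) (λ (_ , r) → rmc⇒stepRight* r) steps

  lift-ancestor* : ∀ {a b} → Dual.ProperAnc a b → a ≢ root →
                   Dual.ProperAnc {node ts} (child i a) (child i b)
  lift-ancestor* [ c ]    a≢root = [ lift-child* c a≢root ]
  lift-ancestor* (c ∷ cs) a≢root = lift-child* c a≢root ∷ lift-ancestor* cs (child*-nonroot c)

  lift-ancestorEq* : ∀ {a b} → Dual.AncEq a b → a ≢ root →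
                     Dual.AncEq {node ts} (child i a) (child i b)
  lift-ancestorEq* ε        _      = ε
  lift-ancestorEq* (c ◅ cs) a≢root = lift-child* c a≢root ◅ lift-ancestorEq* cs (child*-nonroot c)

  -- A T*-child of the root of the i-th subtree lies on the rightmost T-spine below child i root,
  -- so by rule (2) it is a T*-left sibling of child i root and shares its T*-parent.
  reparent* : ∀ {x W} → Dual.ChildOf x root → Dual.ChildOf {node ts} (child i root) W →
              Dual.ChildOf {node ts} (child i x) W
  reparent* (_ , inj₂ s , _) _ = ⊥-elim (ils-source-nonroot s refl)
  reparent* (y , inj₁ (_ , r) , steps) (z , rz , steps′) =
    z , rz , gmap (child i) (λ (_ , r) → rmc⇒stepRight* r) steps ◅◅ rmc⇒stepRight* r ◅ steps′

  descend* : ∀ {X p} → Dual.ProperAnc {node ts} X (child i root) → Dual.AncEq root p →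
             Dual.ProperAnc {node ts} X (child i p)
  descend* X↑i ε        = X↑i
  descend* X↑i (c ◅ cs) = map-last (reparent* c) X↑i ⁺◅◅ lift-ancestorEq* cs (child*-nonroot c)

root-ancestorEq* : ∀ {t} (p : Pos t) → Dual.AncEq root p
root-ancestorEq* root        = ε
root-ancestorEq* (child k p) = ⁺⇒⋆ (descend* k (root-ancestor*-child k) (root-ancestorEq* p))

UnderLeftSibling⇒ancestor* : ∀ {t} {u a : Pos t} → UnderLeftSibling u a → Dual.ProperAnc a u
UnderLeftSibling⇒ancestor* (here {i = i} {p = p} i<j) =
  descend* i (leftOf⇒ancestor* (siblings⇒leftOf i<j)) (root-ancestorEq* p)
UnderLeftSibling⇒ancestor* (there k l) =
  lift-ancestor* k (UnderLeftSibling⇒ancestor* l) (UnderLeftSibling-nonroot l)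

rightmost-spine : ∀ {t} {b u : Pos t} → b ⊏ u →
                  ∃[ a ] (TransClosure RMC b a × (a ≡ u ⊎ UnderLeftSibling u a))
rightmost-spine {node (_ ∷ _)} (here {i = k} {p = q}) with ≡fromℕ⊎<fromℕ k
... | inj₂ k<rmc = child _ root , [ rmc-last ] , inj₂ (here k<rmc)
... | inj₁ refl with root-≼ q
...   | inj₁ refl   = child k root , [ rmc-last ] , inj₁ refl
...   | inj₂ root⊏q with rightmost-spine root⊏q
...     | a , rs , exit =
  child k a , rmc-last ∷ ⁺-gmap (child k) (rmc-there k) rs , Sum.map (cong (child k)) (there k) exit
rightmost-spine (there k b⊏u) with rightmost-spine b⊏u
... | a , rs , exit = child k a , ⁺-gmap (child k) (rmc-there k) rs , Sum.map (cong (child k)) (there k) exit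

⊏-ancestorEq*⇒<* : ∀ {t} {b u v : Pos t} → b ⊏ u → b ≢ root → Dual.AncEq b v → u <* v
⊏-ancestorEq*⇒<* b⊏u b≢root b≼v with rightmost-spine b⊏u
... | a , rs , inj₁ refl = inj₂ (a , _ , rmc⁺⇒leftOf* rs b≢root , ε , b≼v)
... | a , rs , inj₂ l    = inj₂ (a , _ , rmc⁺⇒leftOf* rs b≢root , ⁺⇒⋆ (UnderLeftSibling⇒ancestor* l) , b≼v)

≺⇒<* : ∀ {t} {v u : Pos t} → v ≺ u → v ≢ root → u <* v
≺⇒<* (inj₁ v⊏u) v≢root = ⊏-ancestorEq*⇒<* v⊏u v≢root ε
≺⇒<* (inj₂ v◁u) _ with ◁-split v◁u
... | inj₁ l             = inj₁ (UnderLeftSibling⇒ancestor* l)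
... | inj₂ (b , l , b⊏u) = ⊏-ancestorEq*⇒<* b⊏u (UnderLeftSibling-nonroot l) (⁺⇒⋆ (UnderLeftSibling⇒ancestor* l))

lemma2 : (T : Tree) (u v : Pos T) → ¬ (u ≡ root) → ¬ (v ≡ root) →
    (u <* v) ⇔ (v <T u)
lemma2 T u v u≢root v≢root =
  mk⇔ (λ u<*v → ≺⇒<T (<*⇒≺ u<*v u≢root)) (λ v<u → ≺⇒<* (<T⇒≺ v<u) v≢root)
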